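{- For every $n\ge1$, the map $\mathrm{Ctr}$ is a bijection from $\mathcal{RS}_n$ to $\mathcal{S}_n$; equivalently, for a plane tree $R$ with labels on its leaves, where every internal node has a leaf as its first child, and $S=\mathrm{Ctr}(R)$, we have $R\in\mathcal{RS}_n$ if and only if $S\in\mathcal{S}_n$.
   Context: Plane trees, prefix order (root, then the children's subtrees left to right), depth (root depth $0$). A sticky tree is a plane tree with $\ell:V\to\mathbb{N}$ such that (1) $0\le\ell(w)\le$ depth$(w)$; (2) every node $w$ of depth $d>0$ has some $z$ in the subtree $S_w$ (possibly $w$) with $\ell(z)<d$; (3) for every node $w$ of depth $d$, if some $z\in S_w$ has $\ell(z)=d$, then every node of $S_w$ (including $w$) preceding $z$ in prefix order has label $\ge d$. $\mathcal{S}_n$ is the set of sticky trees with $n$ edges. A decorated tree is a plane tree $R$ with a labeling $\ell$ defined only on its leaves such that: (1') a leaf $f$ attached to a node of depth $d$ satisfies $-1\le\ell(f)\le d-1$; (2') every internal node $u$ of depth $d>0$ has a descendant leaf $f$ with $\ell(f)<d-1$; (3') for every node $t$ of depth $d$ and every child $u$ of $t$, if the subtree $R_u$ contains a leaf $f$ with $\ell(f)=d$, then every leaf of $R_u$ preceding $f$ in prefix order has label $\ge d$. $\mathcal{RS}_n$ is the set of decorated trees with $n+1$ internal nodes and $n+1$ leaves in which every internal node has a leaf as its first (leftmost) child. $\mathrm{Ctr}(R)$: delete all leaves of $R$ and give to each (formerly internal) node the label of its deleted first-child leaf plus $1$. Its inverse adds to each node a new leaf as first child carrying the node's label minus $1$,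 and removes the labels from the nodes. -}

module Defs where

open import Data.Nat as ℕ using (ℕ; zero; suc; _∸_)
open import Data.Integer as ℤ using (ℤ; +_; _+_; _-_; -1ℤ; 0ℤ; 1ℤ)
open import Data.List using (List; []; _∷_; _++_; map; length; lookup)
open import Data.Maybe using (Maybe; just; nothing)
open import Data.Fin as Fin using (Fin)
open import Data.Product using (_×_; _,_; proj₁; proj₂; ∃; ∃₂)
open import Data.Unit using (⊤)
open import Data.Empty using (⊥)
open import Function.Bundles using (_⇔_)
open import Relation.Binary.PropositionalEquality using (_≡_)

-- Addresses of nodes in a plane tree: the root is [], the k-th child
-- (0-based) of the node at address a is at a ++ [k].
Addr : Set
Addr = List ℕ

_⊑_ : Addr → Addr → Set
a ⊑ b = ∃ λ s → b ≡ a ++ s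

_◁_ : Addr → Addr → Set
a ◁ b = ∃ λ k → b ≡ a ++ (k ∷ [])

-- Labelled plane trees (candidate sticky trees). Labels are taken in ℤ
-- so that Ctr is total on labels; condition (1) forces them to be ≥ 0.

data LTree : Set where
  lnode : ℤ → List LTree → LTree

mutual
  lpre : LTree → List (Addr × ℤ)
  lpre (lnode x ts) = ([] , x) ∷ lpres 0 ts

  lpres : ℕ → List LTree → List (Addr × ℤ)
  lpres k [] = []
  lpres k (t ∷ ts) = map (λ p → (k ∷ proj₁ p , proj₂ p)) (lpre t) ++ lpres (suc k) ts

-- nodes of S, identified by their position in prefix order
LNode : LTree → Set
LNode S = Fin (length (lpre S))

lAddr : (S : LTree) → LNode S → Addr
lAddr S w = proj₁ (lookup (lpre S) w)

lLab : (S : LTree) → LNode S → ℤ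
lLab S w = proj₂ (lookup (lpre S) w)

lDepth : (S : LTree) → LNode S → ℕ
lDepth S w = length (lAddr S w)

lInSub : (S : LTree) → LNode S → LNode S → Set
lInSub S w z = lAddr S w ⊑ lAddr S z

lEdges : LTree → ℕ
lEdges S = length (lpre S) ∸ 1

record Sticky (S : LTree) : Set where
  field
    cond1 : ∀ w → (0ℤ ℤ.≤ lLab S w) × (lLab S w ℤ.≤ + lDepth S w)
    cond2 : ∀ w → 0 ℕ.< lDepth S w →
              ∃ λ z → lInSub S w z × (lLab S z ℤ.< + lDepth S w)
    cond3 : ∀ w z → lInSub S w z → lLab S z ≡ + lDepth S w →
              ∀ u → lInSub S w u → u Fin.< z → + lDepth S w ℤ.≤ lLab S u

InS : ℕ → LTree → Set
InS n S = (lEdges S ≡ n) × Sticky S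

-- Plane trees with labels on leaves. An internal node has a nonempty
-- list of children (first child, remaining children).

data DTree : Set where
  leaf  : ℤ → DTree
  inner : DTree → List DTree → DTree

mutual
  dpre : DTree → List (Addr × Maybe ℤ)
  dpre (leaf x) = ([] , just x) ∷ []
  dpre (inner c ts) =
    ([] , nothing) ∷ (map (λ p → (0 ∷ proj₁ p , proj₂ p)) (dpre c) ++ dpres 1 ts)

  dpres : ℕ → List DTree → List (Addr × Maybe ℤ)
  dpres k [] = []
  dpres k (t ∷ ts) = map (λ p → (k ∷ proj₁ p , proj₂ p)) (dpre t) ++ dpres (suc k) ts

DNode : DTree → Set
DNode R = Fin (length (dpre R))

dAddr : (R : DTree) → DNode R → Addr
dAddr R v = proj₁ (lookup (dpre R) v)

dKind : (R : DTree) → DNode R → Maybe ℤ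
dKind R v = proj₂ (lookup (dpre R) v)

dDepth : (R : DTree) → DNode R → ℕ
dDepth R v = length (dAddr R v)

dInSub : (R : DTree) → DNode R → DNode R → Set
dInSub R u f = dAddr R u ⊑ dAddr R f

dChild : (R : DTree) → DNode R → DNode R → Set
dChild R t u = dAddr R t ◁ dAddr R u

record Decorated (R : DTree) : Set where
  field
    cond1 : ∀ t f x → dChild R t f → dKind R f ≡ just x →
              (-1ℤ ℤ.≤ x) × (x ℤ.≤ + dDepth R t - 1ℤ)
    cond2 : ∀ u → dKind R u ≡ nothing → 0 ℕ.< dDepth R u →
              ∃₂ λ f x → dInSub R u f × dKind R f ≡ just x × (x ℤ.< + dDepth R u - 1ℤ)
    cond3 : ∀ t u → dChild R t u →
              ∀ f → dInSub R u f → dKind R f ≡ just (+ dDepth R t) →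
              ∀ g y → dInSub R u g → dKind R g ≡ just y → g Fin.< f →
              + dDepth R t ℤ.≤ y

mutual
  nLeaves : DTree → ℕ
  nLeaves (leaf _) = 1
  nLeaves (inner c ts) = nLeaves c ℕ.+ nLeavesL ts

  nLeavesL : List DTree → ℕ
  nLeavesL [] = 0
  nLeavesL (t ∷ ts) = nLeaves t ℕ.+ nLeavesL ts

mutual
  nInner : DTree → ℕ
  nInner (leaf _) = 0
  nInner (inner c ts) = suc (nInner c ℕ.+ nInnerL ts)

  nInnerL : List DTree → ℕ
  nInnerL [] = 0
  nInnerL (t ∷ ts) = nInner t ℕ.+ nInnerL ts

IsLeaf : DTree → Set
IsLeaf (leaf _) = ⊤
IsLeaf (inner _ _) = ⊥

mutual
  FirstLeaf : DTree → Set
  FirstLeaf (leaf _) = ⊤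
  FirstLeaf (inner c ts) = IsLeaf c × FirstLeaf c × FirstLeafL ts

  FirstLeafL : List DTree → Set
  FirstLeafL [] = ⊤
  FirstLeafL (t ∷ ts) = FirstLeaf t × FirstLeafL ts

Shape : ℕ → DTree → Set
Shape n R = (nInner R ≡ suc n) × (nLeaves R ≡ suc n) × FirstLeaf R

InRS : ℕ → DTree → Set
InRS n R = Shape n R × Decorated R

-- Ctr: delete all leaves, each internal node gets the label of its first
-- child leaf plus 1. (Values on trees outside its domain — a single leaf,
-- or an internal node whose first child is internal — are junk and never
-- used, since the statement only applies Ctr under FirstLeaf.)

mutual
  Ctr : DTree → LTree
  Ctr (leaf _) = lnode 0ℤ []
  Ctr (inner (leaf x) ts) = lnode (x + 1ℤ) (Ctrs ts)
  Ctr (inner (inner _ _) ts) = lnode 0ℤ []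

  Ctrs : List DTree → List LTree
  Ctrs [] = []
  Ctrs (leaf _ ∷ ts) = Ctrs ts
  Ctrs (t@(inner _ _) ∷ ts) = Ctr t ∷ Ctrs ts

-- Ctr⁻¹ S gives every node of S a new first child, a leaf labelled one less. A node at
-- address a of S thus becomes an internal node at address map suc a, immediately followed
-- in prefix order by its new leaf, so the prefix listing of Ctr⁻¹ S is that of S with
-- every entry doubled. Along this correspondence condition (1) at a node w of S is (1')
-- at the new leaf of w, (2) at w is (2') at w, and (3) at w is (3') at the parent of w
-- and its child w, the labels of the new leaves being the labels of S shifted by one.
-- Conversely, when every internal node has a leaf as first child, the leaves number at
-- least the internal nodes, with equality exactly when all leaves are first children,
-- i.e. when R = Ctr⁻¹ (Ctr R).

module Submission where

open import Defs
open import Data.Nat as ℕ using (ℕ; suc; _≤_)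
import Data.Nat.Properties as ℕ
open import Data.Integer as ℤ using (ℤ; +_; _+_; _-_; -1ℤ; 0ℤ; 1ℤ)
import Data.Integer.Properties as ℤ
open import Data.List using (List; []; _∷_; _++_; _∷ʳ_; map; length; lookup; initLast; _∷ʳ′_)
open import Data.List.Properties
  using (∷-injective; ∷-injectiveˡ; ∷-injectiveʳ; ∷ʳ-injectiveˡ; map-++; ++-assoc; length-map; length-++)
open import Data.List.Relation.Unary.Any as Any using (Any; here; there; index; satisfied)
open import Data.List.Membership.Propositional.Properties using (∈-lookup)
open import Data.List.Relation.Unary.Any.Properties
  using (lookup-index; map⁺; map⁻; ++⁺ˡ; ++⁺ʳ; ++⁻)
open import Data.Maybe using (Maybe; just; nothing)
open import Data.Maybe.Properties using (just-injective)
open import Data.Fin as Fin using (Fin)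
open import Data.Product using (_×_; _,_; proj₁; proj₂; ∃; map₁)
open import Data.Product.Function.NonDependent.Propositional using (_×-⇔_)
open import Data.Sum using (_⊎_; inj₁; inj₂)
open import Data.Unit using (tt)
open import Data.Empty using (⊥; ⊥-elim)
open import Function.Bundles using (_⇔_; mk⇔; Equivalence)
open import Function.Related.Propositional using (module EquationalReasoning)
open import Relation.Binary.PropositionalEquality

i-1+1≡i : ∀ i → i - 1ℤ + 1ℤ ≡ i
i-1+1≡i i = trans (ℤ.+-assoc i -1ℤ 1ℤ) (ℤ.+-identityʳ i)

i+1-1≡i : ∀ i → i + 1ℤ - 1ℤ ≡ i
i+1-1≡i i = trans (ℤ.+-assoc i 1ℤ -1ℤ) (ℤ.+-identityʳ i)

-1-mono-≤ : ∀ {i j} → i ℤ.≤ j → i - 1ℤ ℤ.≤ j - 1ℤ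
-1-mono-≤ = ℤ.+-monoˡ-≤ -1ℤ

-1-mono-< : ∀ {i j} → i ℤ.< j → i - 1ℤ ℤ.< j - 1ℤ
-1-mono-< = ℤ.+-monoˡ-< -1ℤ

-1-cancel-≤ : ∀ {i j} → i - 1ℤ ℤ.≤ j - 1ℤ → i ℤ.≤ j
-1-cancel-≤ {i} {j} p = subst₂ ℤ._≤_ (i-1+1≡i i) (i-1+1≡i j) (ℤ.+-monoˡ-≤ 1ℤ p)

-1-cancel-< : ∀ {i j} → i - 1ℤ ℤ.< j - 1ℤ → i ℤ.< j
-1-cancel-< {i} {j} p = subst₂ ℤ._<_ (i-1+1≡i i) (i-1+1≡i j) (ℤ.+-monoˡ-< 1ℤ p)

i≰i-1 : ∀ {i} → i ℤ.≤ i - 1ℤ → ⊥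
i≰i-1 {i} p = ℤ.<-irrefl refl (ℤ.i≤pred[j]⇒i<j (subst (i ℤ.≤_) (ℤ.+-comm i -1ℤ) p))

m≤n⇒o≤p⇒m+o≡n+p⇒m≡n : ∀ {m n o p} → m ≤ n → o ≤ p → m ℕ.+ o ≡ n ℕ.+ p → m ≡ n
m≤n⇒o≤p⇒m+o≡n+p⇒m≡n {m} {n} {o} {p} m≤n o≤p eq = ℕ.≤-antisym m≤n n≤m
  where
  n≤m : n ≤ m
  n≤m = ℕ.+-cancelʳ-≤ p n m (subst (ℕ._≤ m ℕ.+ p) eq (ℕ.+-monoʳ-≤ m o≤p))

length-∷ʳ : ∀ {A : Set} (xs : List A) x → length (xs ∷ʳ x) ≡ suc (length xs)
length-∷ʳ xs x = trans (length-++ xs) (ℕ.+-comm (length xs) 1)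

mutual
  Ctr⁻¹ : LTree → DTree
  Ctr⁻¹ (lnode x ts) = inner (leaf (x - 1ℤ)) (Ctr⁻¹s ts)

  Ctr⁻¹s : List LTree → List DTree
  Ctr⁻¹s [] = []
  Ctr⁻¹s (t ∷ ts) = Ctr⁻¹ t ∷ Ctr⁻¹s ts

mutual
  Ctr∘Ctr⁻¹ : ∀ S → Ctr (Ctr⁻¹ S) ≡ S
  Ctr∘Ctr⁻¹ (lnode x ts) = cong₂ lnode (i-1+1≡i x) (Ctrs∘Ctr⁻¹s ts)

  Ctrs∘Ctr⁻¹s : ∀ ts → Ctrs (Ctr⁻¹s ts) ≡ ts
  Ctrs∘Ctr⁻¹s [] = refl
  Ctrs∘Ctr⁻¹s (t@(lnode _ _) ∷ ts) = cong₂ _∷_ (Ctr∘Ctr⁻¹ t) (Ctrs∘Ctr⁻¹s ts)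

mutual
  FirstLeaf-Ctr⁻¹ : ∀ S → FirstLeaf (Ctr⁻¹ S)
  FirstLeaf-Ctr⁻¹ (lnode x ts) = tt , tt , FirstLeafL-Ctr⁻¹s ts

  FirstLeafL-Ctr⁻¹s : ∀ ts → FirstLeafL (Ctr⁻¹s ts)
  FirstLeafL-Ctr⁻¹s [] = tt
  FirstLeafL-Ctr⁻¹s (t ∷ ts) = FirstLeaf-Ctr⁻¹ t , FirstLeafL-Ctr⁻¹s ts

mutual
  nLeaves≡nInner-Ctr⁻¹ : ∀ S → nLeaves (Ctr⁻¹ S) ≡ nInner (Ctr⁻¹ S)
  nLeaves≡nInner-Ctr⁻¹ (lnode x ts) = cong suc (nLeavesL≡nInnerL-Ctr⁻¹s ts)

  nLeavesL≡nInnerL-Ctr⁻¹s : ∀ ts → nLeavesL (Ctr⁻¹s ts) ≡ nInnerL (Ctr⁻¹s ts)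
  nLeavesL≡nInnerL-Ctr⁻¹s [] = refl
  nLeavesL≡nInnerL-Ctr⁻¹s (t ∷ ts) = cong₂ ℕ._+_ (nLeaves≡nInner-Ctr⁻¹ t) (nLeavesL≡nInnerL-Ctr⁻¹s ts)

mutual
  nInner-Ctr⁻¹ : ∀ S → nInner (Ctr⁻¹ S) ≡ length (lpre S)
  nInner-Ctr⁻¹ (lnode x ts) = cong suc (nInnerL-Ctr⁻¹s 0 ts)

  nInnerL-Ctr⁻¹s : ∀ k ts → nInnerL (Ctr⁻¹s ts) ≡ length (lpres k ts)
  nInnerL-Ctr⁻¹s k [] = refl
  nInnerL-Ctr⁻¹s k (t ∷ ts) = begin
    nInner (Ctr⁻¹ t) ℕ.+ nInnerL (Ctr⁻¹s ts)
      ≡⟨ cong₂ ℕ._+_ (nInner-Ctr⁻¹ t) (nInnerL-Ctr⁻¹s (suc k) ts) ⟩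
    length (lpre t) ℕ.+ length (lpres (suc k) ts)
      ≡⟨ cong (ℕ._+ _) (length-map (map₁ (k ∷_)) (lpre t)) ⟨
    length (map (map₁ (k ∷_)) (lpre t)) ℕ.+ length (lpres (suc k) ts)
      ≡⟨ length-++ (map (map₁ (k ∷_)) (lpre t)) ⟨
    length (lpres k (t ∷ ts))
      ∎
    where open ≡-Reasoning

Shape-Ctr⁻¹⇔lEdges : ∀ n S → Shape n (Ctr⁻¹ S) ⇔ (lEdges S ≡ n)
Shape-Ctr⁻¹⇔lEdges n S@(lnode _ _) = mk⇔ to from
  where
  to : Shape n (Ctr⁻¹ S) → lEdges S ≡ n
  to (inner≡ , _ , _) = cong (ℕ._∸ 1) (trans (sym (nInner-Ctr⁻¹ S)) inner≡)

  from : lEdges S ≡ n → Shape n (Ctr⁻¹ S)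
  from edges≡ = inner≡ , trans (nLeaves≡nInner-Ctr⁻¹ S) inner≡ , FirstLeaf-Ctr⁻¹ S
    where
    inner≡ : nInner (Ctr⁻¹ S) ≡ suc n
    inner≡ = trans (nInner-Ctr⁻¹ S) (cong suc edges≡)

mutual
  nInner≤nLeaves : ∀ R → FirstLeaf R → nInner R ≤ nLeaves R
  nInner≤nLeaves (leaf _) _ = ℕ.z≤n
  nInner≤nLeaves (inner (leaf _) ts) (_ , _ , fl) = ℕ.s≤s (nInnerL≤nLeavesL ts fl)

  nInnerL≤nLeavesL : ∀ ts → FirstLeafL ts → nInnerL ts ≤ nLeavesL ts
  nInnerL≤nLeavesL [] _ = ℕ.z≤n
  nInnerL≤nLeavesL (t ∷ ts) (fl , fls) = ℕ.+-mono-≤ (nInner≤nLeaves t fl) (nInnerL≤nLeavesL ts fls)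

mutual
  balanced⇒Ctr⁻¹-image : ∀ R → FirstLeaf R → nInner R ≡ nLeaves R → ∃ λ S → Ctr⁻¹ S ≡ R
  balanced⇒Ctr⁻¹-image (inner (leaf x) ts) (_ , _ , fl) eq
    with balancedL⇒Ctr⁻¹s-image ts fl (ℕ.suc-injective eq)
  ... | ss , refl = lnode (x + 1ℤ) ss , cong (λ y → inner (leaf y) (Ctr⁻¹s ss)) (i+1-1≡i x)

  balancedL⇒Ctr⁻¹s-image : ∀ ts → FirstLeafL ts → nInnerL ts ≡ nLeavesL ts → ∃ λ ss → Ctr⁻¹s ss ≡ ts
  balancedL⇒Ctr⁻¹s-image [] _ _ = [] , refl
  balancedL⇒Ctr⁻¹s-image (t ∷ ts) (fl , fls) eq
    with t≡ ← m≤n⇒o≤p⇒m+o≡n+p⇒m≡n (nInner≤nLeaves t fl) (nInnerL≤nLeavesL ts fls) eq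
    with ts≡ ← ℕ.+-cancelˡ-≡ (nInner t) _ _ (trans eq (cong (ℕ._+ _) (sym t≡)))
    with balanced⇒Ctr⁻¹-image t fl t≡ | balancedL⇒Ctr⁻¹s-image ts fls ts≡
  ... | s , refl | ss , refl = s ∷ ss , refl

Shape⇒Ctr⁻¹-image : ∀ {n} R → Shape n R → ∃ λ S → Ctr⁻¹ S ≡ R
Shape⇒Ctr⁻¹-image R (inner≡ , leaves≡ , fl) = balanced⇒Ctr⁻¹-image R fl (trans inner≡ (sym leaves≡))

Ctr⁻¹∘Ctr : ∀ {n} R → Shape n R → Ctr⁻¹ (Ctr R) ≡ R
Ctr⁻¹∘Ctr R shape with Shape⇒Ctr⁻¹-image R shape
... | S , refl = cong Ctr⁻¹ (Ctr∘Ctr⁻¹ S)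

addrAt : {A : Set} (L : List (Addr × A)) → Fin (length L) → Addr
addrAt L i = proj₁ (lookup L i)

valueAt : {A : Set} (L : List (Addr × A)) → Fin (length L) → A
valueAt L i = proj₂ (lookup L i)

depthAt : {A : Set} (L : List (Addr × A)) → Fin (length L) → ℕ
depthAt L i = length (addrAt L i)

-- Sticky and Decorated for an arbitrary prefix listing, so that dpre (Ctr⁻¹ S) can be
-- rewritten to expand (lpre S).

record StickyListing (L : List (Addr × ℤ)) : Set where
  field
    cond1 : ∀ w → (0ℤ ℤ.≤ valueAt L w) × (valueAt L w ℤ.≤ + depthAt L w)
    cond2 : ∀ w → 0 ℕ.< depthAt L w →
              ∃ λ z → (addrAt L w ⊑ addrAt L z) × (valueAt L z ℤ.< + depthAt L w)
    cond3 : ∀ w z → addrAt L w ⊑ addrAt L z → valueAt L z ≡ + depthAt L w →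
              ∀ u → addrAt L w ⊑ addrAt L u → u Fin.< z → + depthAt L w ℤ.≤ valueAt L u

record DecoratedListing (E : List (Addr × Maybe ℤ)) : Set where
  field
    cond1 : ∀ t f x → addrAt E t ◁ addrAt E f → valueAt E f ≡ just x →
              (-1ℤ ℤ.≤ x) × (x ℤ.≤ + depthAt E t - 1ℤ)
    cond2 : ∀ u → valueAt E u ≡ nothing → 0 ℕ.< depthAt E u →
              ∃ λ f → ∃ λ x → (addrAt E u ⊑ addrAt E f) × valueAt E f ≡ just x
                              × (x ℤ.< + depthAt E u - 1ℤ)
    cond3 : ∀ t u → addrAt E t ◁ addrAt E u →
              ∀ f → addrAt E u ⊑ addrAt E f → valueAt E f ≡ just (+ depthAt E t) →
              ∀ g y → addrAt E u ⊑ addrAt E g → valueAt E g ≡ just y → g Fin.< f →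
              + depthAt E t ℤ.≤ y

StickyListing⇔Sticky : ∀ S → StickyListing (lpre S) ⇔ Sticky S
StickyListing⇔Sticky S = mk⇔
  (λ s → let open StickyListing s in record { cond1 = cond1 ; cond2 = cond2 ; cond3 = cond3 })
  (λ s → let open Sticky s in record { cond1 = cond1 ; cond2 = cond2 ; cond3 = cond3 })

Decorated⇔DecoratedListing : ∀ R → Decorated R ⇔ DecoratedListing (dpre R)
Decorated⇔DecoratedListing R = mk⇔
  (λ d → let open Decorated d in record { cond1 = cond1 ; cond2 = cond2 ; cond3 = cond3 })
  (λ d → let open DecoratedListing d in record { cond1 = cond1 ; cond2 = cond2 ; cond3 = cond3 })

shiftAddr : Addr → Addr
shiftAddr = map suc

innerEntry : Addr × ℤ → Addr × Maybe ℤ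
innerEntry (a , _) = shiftAddr a , nothing

leafEntry : Addr × ℤ → Addr × Maybe ℤ
leafEntry (a , x) = shiftAddr a ∷ʳ 0 , just (x - 1ℤ)

expand : List (Addr × ℤ) → List (Addr × Maybe ℤ)
expand [] = []
expand (p ∷ L) = innerEntry p ∷ leafEntry p ∷ expand L

expand-++ : ∀ L M → expand (L ++ M) ≡ expand L ++ expand M
expand-++ [] M = refl
expand-++ (p ∷ L) M = cong (λ E → _ ∷ _ ∷ E) (expand-++ L M)

expand-map₁ : ∀ k L → expand (map (map₁ (k ∷_)) L) ≡ map (map₁ (suc k ∷_)) (expand L)
expand-map₁ k [] = refl
expand-map₁ k (p ∷ L) = cong (λ E → _ ∷ _ ∷ E) (expand-map₁ k L)

mutual
  dpre-Ctr⁻¹ : ∀ S → dpre (Ctr⁻¹ S) ≡ expand (lpre S)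
  dpre-Ctr⁻¹ (lnode x ts) = cong (λ E → _ ∷ _ ∷ E) (dpres-Ctr⁻¹s 0 ts)

  dpres-Ctr⁻¹s : ∀ k ts → dpres (suc k) (Ctr⁻¹s ts) ≡ expand (lpres k ts)
  dpres-Ctr⁻¹s k [] = refl
  dpres-Ctr⁻¹s k (t ∷ ts) = begin
    map (map₁ (suc k ∷_)) (dpre (Ctr⁻¹ t)) ++ dpres (suc (suc k)) (Ctr⁻¹s ts)
      ≡⟨ cong₂ _++_ (cong (map (map₁ (suc k ∷_))) (dpre-Ctr⁻¹ t)) (dpres-Ctr⁻¹s (suc k) ts) ⟩
    map (map₁ (suc k ∷_)) (expand (lpre t)) ++ expand (lpres (suc k) ts)
      ≡⟨ cong (_++ _) (expand-map₁ k (lpre t)) ⟨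
    expand (map (map₁ (k ∷_)) (lpre t)) ++ expand (lpres (suc k) ts)
      ≡⟨ expand-++ (map (map₁ (k ∷_)) (lpre t)) _ ⟨
    expand (lpres k (t ∷ ts))
      ∎
    where open ≡-Reasoning

innerPos : ∀ L → Fin (length L) → Fin (length (expand L))
innerPos (_ ∷ L) Fin.zero = Fin.zero
innerPos (_ ∷ L) (Fin.suc i) = Fin.suc (Fin.suc (innerPos L i))

leafPos : ∀ L → Fin (length L) → Fin (length (expand L))
leafPos (_ ∷ L) Fin.zero = Fin.suc Fin.zero
leafPos (_ ∷ L) (Fin.suc i) = Fin.suc (Fin.suc (leafPos L i))

data ExpandedPos (L : List (Addr × ℤ)) : Fin (length (expand L)) → Set where
  inner : ∀ i → ExpandedPos L (innerPos L i)
  leaf  : ∀ i → ExpandedPos L (leafPos L i)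

expandedPos : ∀ L v → ExpandedPos L v
expandedPos (_ ∷ L) Fin.zero = inner Fin.zero
expandedPos (_ ∷ L) (Fin.suc Fin.zero) = leaf Fin.zero
expandedPos (_ ∷ L) (Fin.suc (Fin.suc v)) with expandedPos L v
... | inner i = inner (Fin.suc i)
... | leaf i = leaf (Fin.suc i)

lookup-innerPos : ∀ L i → lookup (expand L) (innerPos L i) ≡ innerEntry (lookup L i)
lookup-innerPos (_ ∷ L) Fin.zero = refl
lookup-innerPos (_ ∷ L) (Fin.suc i) = lookup-innerPos L i

lookup-leafPos : ∀ L i → lookup (expand L) (leafPos L i) ≡ leafEntry (lookup L i)
lookup-leafPos (_ ∷ L) Fin.zero = refl
lookup-leafPos (_ ∷ L) (Fin.suc i) = lookup-leafPos L i

leafPos-mono-< : ∀ L {i j} → i Fin.< j → leafPos L i Fin.< leafPos L j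
leafPos-mono-< (_ ∷ L) {Fin.zero} {Fin.suc j} _ = ℕ.s≤s (ℕ.s≤s ℕ.z≤n)
leafPos-mono-< (_ ∷ L) {Fin.suc i} {Fin.suc j} (ℕ.s≤s i<j) = ℕ.s≤s (ℕ.s≤s (leafPos-mono-< L i<j))

leafPos-cancel-< : ∀ L {i j} → leafPos L i Fin.< leafPos L j → i Fin.< j
leafPos-cancel-< (_ ∷ L) {Fin.zero} {Fin.zero} (ℕ.s≤s ())
leafPos-cancel-< (_ ∷ L) {Fin.zero} {Fin.suc j} _ = ℕ.s≤s ℕ.z≤n
leafPos-cancel-< (_ ∷ L) {Fin.suc i} {Fin.zero} (ℕ.s≤s ())
leafPos-cancel-< (_ ∷ L) {Fin.suc i} {Fin.suc j} (ℕ.s≤s (ℕ.s≤s p)) = ℕ.s≤s (leafPos-cancel-< L p)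

shiftAddr-⊑ : ∀ a b → a ⊑ b → shiftAddr a ⊑ (shiftAddr b ∷ʳ 0)
shiftAddr-⊑ a _ (s , refl) =
  shiftAddr s ∷ʳ 0 , trans (cong (_∷ʳ 0) (map-++ suc a s)) (++-assoc (shiftAddr a) _ _)

shiftAddr-⊑⁻¹ : ∀ a b → shiftAddr a ⊑ (shiftAddr b ∷ʳ 0) → a ⊑ b
shiftAddr-⊑⁻¹ [] b _ = b , refl
shiftAddr-⊑⁻¹ (x ∷ a) [] (_ , ())
shiftAddr-⊑⁻¹ (x ∷ a) (y ∷ b) (s , eq)
  with refl , eq′ ← ∷-injective eq
  with s′ , eq″ ← shiftAddr-⊑⁻¹ a b (s , eq′) = s′ , cong (x ∷_) eq″

-- A 0 occurs in a shifted leaf address only as its last entry.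
leafAddr-⊑⇒≡ : ∀ a b → (shiftAddr a ∷ʳ 0) ⊑ (shiftAddr b ∷ʳ 0) → b ≡ a
leafAddr-⊑⇒≡ [] [] _ = refl
leafAddr-⊑⇒≡ [] (_ ∷ _) (_ , ())
leafAddr-⊑⇒≡ (_ ∷ _) [] (_ , ())
leafAddr-⊑⇒≡ (x ∷ a) (y ∷ b) (s , eq) with refl , eq′ ← ∷-injective eq =
  cong (x ∷_) (leafAddr-⊑⇒≡ a b (s , eq′))

PrefixClosed : List (Addr × ℤ) → Set
PrefixClosed L = ∀ a b → Any (λ e → proj₁ e ≡ a ++ b) L → Any (λ e → proj₁ e ≡ a) L

mutual
  lpre-prefixClosed : ∀ S → PrefixClosed (lpre S)
  lpre-prefixClosed (lnode x ts) [] b _ = here refl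
  lpre-prefixClosed (lnode x ts) (c ∷ a) b (there h) = there (lpres-prefixClosed 0 ts c a b h)

  lpres-prefixClosed : ∀ k ts c a b → Any (λ e → proj₁ e ≡ c ∷ a ++ b) (lpres k ts)
                                    → Any (λ e → proj₁ e ≡ c ∷ a) (lpres k ts)
  lpres-prefixClosed k (t ∷ ts) c a b h with ++⁻ (map (map₁ (k ∷_)) (lpre t)) h
  ... | inj₂ h′ = ++⁺ʳ (map (map₁ (k ∷_)) (lpre t)) (lpres-prefixClosed (suc k) ts c a b h′)
  ... | inj₁ h′ with h″ ← map⁻ h′ with k≡c ← ∷-injectiveˡ (proj₂ (satisfied h″)) =
    ++⁺ˡ (map⁺ (Any.map (cong₂ _∷_ k≡c) (lpre-prefixClosed t a b (Any.map ∷-injectiveʳ h″))))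

module Expansion (L : List (Addr × ℤ)) where

  addr : Fin (length L) → Addr
  addr = addrAt L

  label : Fin (length L) → ℤ
  label = valueAt L

  depth : Fin (length L) → ℕ
  depth = depthAt L

  addr′ : Fin (length (expand L)) → Addr
  addr′ = addrAt (expand L)

  kind′ : Fin (length (expand L)) → Maybe ℤ
  kind′ = valueAt (expand L)

  depth′ : Fin (length (expand L)) → ℕ
  depth′ = depthAt (expand L)

  addr′-inner : ∀ i → addr′ (innerPos L i) ≡ shiftAddr (addr i)
  addr′-inner i = cong proj₁ (lookup-innerPos L i)

  addr′-leaf : ∀ i → addr′ (leafPos L i) ≡ shiftAddr (addr i) ∷ʳ 0
  addr′-leaf i = cong proj₁ (lookup-leafPos L i)

  kind′-inner : ∀ i → kind′ (innerPos L i) ≡ nothing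
  kind′-inner i = cong proj₂ (lookup-innerPos L i)

  kind′-inner≢just : ∀ i {x} → kind′ (innerPos L i) ≢ just x
  kind′-inner≢just i eq with () ← trans (sym (kind′-inner i)) eq

  kind′-leaf : ∀ i → kind′ (leafPos L i) ≡ just (label i - 1ℤ)
  kind′-leaf i = cong proj₂ (lookup-leafPos L i)

  kind′-leaf⇒ : ∀ i {x} → kind′ (leafPos L i) ≡ just x → x ≡ label i - 1ℤ
  kind′-leaf⇒ i eq = just-injective (trans (sym eq) (kind′-leaf i))

  depth′-inner : ∀ i → depth′ (innerPos L i) ≡ depth i
  depth′-inner i = trans (cong length (addr′-inner i)) (length-map suc (addr i))

  depth′-parent-of-leaf : ∀ {t} i → addr′ t ◁ addr′ (leafPos L i) → depth′ t ≡ depth i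
  depth′-parent-of-leaf i (_ , eq) =
    trans (cong length (∷ʳ-injectiveˡ _ _ (trans (sym eq) (addr′-leaf i)))) (length-map suc (addr i))

  depth′-parent-of-inner : ∀ {t} i → addr′ t ◁ addr′ (innerPos L i) → suc (depth′ t) ≡ depth i
  depth′-parent-of-inner {t} i (k , eq) = begin
    suc (depth′ t)              ≡⟨ length-∷ʳ (addr′ t) k ⟨
    length (addr′ t ∷ʳ k)       ≡⟨ cong length (trans (sym eq) (addr′-inner i)) ⟩
    length (shiftAddr (addr i)) ≡⟨ length-map suc (addr i) ⟩
    depth i                     ∎
    where open ≡-Reasoning

  inner⊑leaf : ∀ i j → addr i ⊑ addr j → addr′ (innerPos L i) ⊑ addr′ (leafPos L j)
  inner⊑leaf i j sub =
    subst₂ _⊑_ (sym (addr′-inner i)) (sym (addr′-leaf j)) (shiftAddr-⊑ (addr i) (addr j) sub)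

  inner⊑leaf⁻¹ : ∀ i j → addr′ (innerPos L i) ⊑ addr′ (leafPos L j) → addr i ⊑ addr j
  inner⊑leaf⁻¹ i j sub =
    shiftAddr-⊑⁻¹ (addr i) (addr j) (subst₂ _⊑_ (addr′-inner i) (addr′-leaf j) sub)

  leaf⊑leaf⇒≡ : ∀ i j → addr′ (leafPos L i) ⊑ addr′ (leafPos L j) →
                addr′ (leafPos L j) ≡ addr′ (leafPos L i)
  leaf⊑leaf⇒≡ i j sub = begin
    addr′ (leafPos L j)       ≡⟨ addr′-leaf j ⟩
    shiftAddr (addr j) ∷ʳ 0   ≡⟨ cong (λ a → shiftAddr a ∷ʳ 0) (leafAddr-⊑⇒≡ (addr i) (addr j) sub′) ⟩
    shiftAddr (addr i) ∷ʳ 0   ≡⟨ addr′-leaf i ⟨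
    addr′ (leafPos L i)       ∎
    where
    open ≡-Reasoning
    sub′ : (shiftAddr (addr i) ∷ʳ 0) ⊑ (shiftAddr (addr j) ∷ʳ 0)
    sub′ = subst₂ _⊑_ (addr′-leaf i) (addr′-leaf j) sub

  root-or-child : PrefixClosed L → ∀ w →
                  depth w ≡ 0 ⊎ ∃ λ t → (addr′ t ◁ addr′ (innerPos L w)) × suc (depth′ t) ≡ depth w
  root-or-child closed w with addr w in eq
  ... | a with initLast a
  ...   | [] = inj₁ refl
  ...   | p ∷ʳ′ m = inj₂ (innerPos L parent , (suc m , addr′-w) , d≡)
    where
    parent-exists : Any (λ e → proj₁ e ≡ p) L
    parent-exists = closed p (m ∷ []) (Any.map (λ w≡ → trans (cong proj₁ (sym w≡)) eq) (∈-lookup w))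
    parent : Fin (length L)
    parent = index parent-exists
    addr′-parent : addr′ (innerPos L parent) ≡ shiftAddr p
    addr′-parent = trans (addr′-inner parent) (cong shiftAddr (lookup-index parent-exists))
    addr′-w : addr′ (innerPos L w) ≡ addr′ (innerPos L parent) ∷ʳ suc m
    addr′-w = begin
      addr′ (innerPos L w)               ≡⟨ addr′-inner w ⟩
      shiftAddr (addr w)                 ≡⟨ cong shiftAddr eq ⟩
      shiftAddr (p ∷ʳ m)                 ≡⟨ map-++ suc p (m ∷ []) ⟩
      shiftAddr p ∷ʳ suc m               ≡⟨ cong (_∷ʳ suc m) addr′-parent ⟨
      addr′ (innerPos L parent) ∷ʳ suc m ∎
      where open ≡-Reasoning
    d≡ : suc (depth′ (innerPos L parent)) ≡ length (p ∷ʳ m)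
    d≡ = trans (cong (λ a → suc (length a)) addr′-parent)
               (trans (cong suc (length-map suc p)) (sym (length-∷ʳ p m)))

  module FromSticky (s : StickyListing L) where
    open StickyListing s

    dcond1 : ∀ t f x → addr′ t ◁ addr′ f → kind′ f ≡ just x →
               (-1ℤ ℤ.≤ x) × (x ℤ.≤ + depth′ t - 1ℤ)
    dcond1 t f x t◁f kf with expandedPos L f
    ... | inner i with () ← kind′-inner≢just i kf
    ... | leaf i rewrite kind′-leaf⇒ i kf | depth′-parent-of-leaf i t◁f =
      -1-mono-≤ (proj₁ (cond1 i)) , -1-mono-≤ (proj₂ (cond1 i))

    dcond2 : ∀ u → kind′ u ≡ nothing → 0 ℕ.< depth′ u →
               ∃ λ f → ∃ λ x → (addr′ u ⊑ addr′ f) × kind′ f ≡ just x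
                               × (x ℤ.< + depth′ u - 1ℤ)
    dcond2 u ku pos with expandedPos L u
    ... | leaf i with () ← trans (sym ku) (kind′-leaf i)
    ... | inner i rewrite depth′-inner i with cond2 i pos
    ... | z , i⊑z , ℓz<d =
      leafPos L z , label z - 1ℤ , inner⊑leaf i z i⊑z , kind′-leaf z , -1-mono-< ℓz<d

    -- If u is itself a leaf then f = u is a child of t, so (1') already bounds its label by depth t - 1.
    dcond3 : ∀ t u → addr′ t ◁ addr′ u →
               ∀ f → addr′ u ⊑ addr′ f → kind′ f ≡ just (+ depth′ t) →
               ∀ g y → addr′ u ⊑ addr′ g → kind′ g ≡ just y → g Fin.< f →
               + depth′ t ℤ.≤ y
    dcond3 t u t◁u f u⊑f kf g y u⊑g kg g<f with expandedPos L f | expandedPos L g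
    ... | inner j | _ with () ← kind′-inner≢just j kf
    ... | _ | inner k with () ← kind′-inner≢just k kg
    ... | leaf j | leaf k with expandedPos L u
    ...   | leaf i = ⊥-elim (i≰i-1 (proj₂ (dcond1 t (leafPos L j) _ t◁f kf)))
      where
      t◁f : addr′ t ◁ addr′ (leafPos L j)
      t◁f = proj₁ t◁u , trans (leaf⊑leaf⇒≡ i j u⊑f) (proj₂ t◁u)
    ...   | inner i rewrite kind′-leaf⇒ k kg =
      -1-mono-≤ (subst (λ d → + d ℤ.≤ label k) (sym d≡)
        (cond3 i j (inner⊑leaf⁻¹ i j u⊑f) ℓj k (inner⊑leaf⁻¹ i k u⊑g) (leafPos-cancel-< L g<f)))
      where
      d≡ : suc (depth′ t) ≡ depth i
      d≡ = depth′-parent-of-inner i t◁u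
      ℓj : label j ≡ + depth i
      ℓj = begin
        label j               ≡⟨ i-1+1≡i (label j) ⟨
        label j - 1ℤ + 1ℤ     ≡⟨ cong (_+ 1ℤ) (kind′-leaf⇒ j kf) ⟨
        + depth′ t + 1ℤ       ≡⟨ cong +_ (trans (ℕ.+-comm _ 1) d≡) ⟩
        + depth i             ∎
        where open ≡-Reasoning

  module FromDecorated (closed : PrefixClosed L) (d : DecoratedListing (expand L)) where
    open DecoratedListing d

    inner◁leaf : ∀ i → addr′ (innerPos L i) ◁ addr′ (leafPos L i)
    inner◁leaf i = 0 , trans (addr′-leaf i) (cong (_∷ʳ 0) (sym (addr′-inner i)))

    scond1 : ∀ w → (0ℤ ℤ.≤ label w) × (label w ℤ.≤ + depth w)
    scond1 w with cond1 (innerPos L w) (leafPos L w) _ (inner◁leaf w) (kind′-leaf w)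
    ... | lo , hi rewrite depth′-inner w = -1-cancel-≤ lo , -1-cancel-≤ hi

    scond2 : ∀ w → 0 ℕ.< depth w → ∃ λ z → (addr w ⊑ addr z) × (label z ℤ.< + depth w)
    scond2 w pos with cond2 (innerPos L w) (kind′-inner w) (subst (0 ℕ.<_) (sym (depth′-inner w)) pos)
    ... | f , x , w⊑f , kf , x<d with expandedPos L f
    ...   | inner j with () ← kind′-inner≢just j kf
    ...   | leaf j rewrite kind′-leaf⇒ j kf | depth′-inner w =
      j , inner⊑leaf⁻¹ w j w⊑f , -1-cancel-< x<d

    scond3 : ∀ w z → addr w ⊑ addr z → label z ≡ + depth w →
               ∀ u → addr w ⊑ addr u → u Fin.< z → + depth w ℤ.≤ label u
    scond3 w z w⊑z ℓz u w⊑u u<z with root-or-child closed w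
    ... | inj₁ root = subst (λ d → + d ℤ.≤ label u) (sym root) (proj₁ (scond1 u))
    ... | inj₂ (t , t◁w , d≡) =
      subst (λ d → + d ℤ.≤ label u) d≡ (-1-cancel-≤ {+ suc (depth′ t)} t-bound)
      where
      kz : kind′ (leafPos L z) ≡ just (+ depth′ t)
      kz = trans (kind′-leaf z) (cong (λ x → just (x - 1ℤ)) (trans ℓz (cong +_ (sym d≡))))
      t-bound : + depth′ t ℤ.≤ label u - 1ℤ
      t-bound = cond3 t (innerPos L w) t◁w (leafPos L z) (inner⊑leaf w z w⊑z) kz
                      (leafPos L u) _ (inner⊑leaf w u w⊑u) (kind′-leaf u) (leafPos-mono-< L u<z)

  DecoratedListing⇔StickyListing : PrefixClosed L → DecoratedListing (expand L) ⇔ StickyListing L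
  DecoratedListing⇔StickyListing closed = mk⇔
    (λ d → let open FromDecorated closed d in record { cond1 = scond1 ; cond2 = scond2 ; cond3 = scond3 })
    (λ s → let open FromSticky s in record { cond1 = dcond1 ; cond2 = dcond2 ; cond3 = dcond3 })

Decorated-Ctr⁻¹⇔Sticky : ∀ S → Decorated (Ctr⁻¹ S) ⇔ Sticky S
Decorated-Ctr⁻¹⇔Sticky S = begin
  Decorated (Ctr⁻¹ S)                 ∼⟨ Decorated⇔DecoratedListing (Ctr⁻¹ S) ⟩
  DecoratedListing (dpre (Ctr⁻¹ S))   ≡⟨ cong DecoratedListing (dpre-Ctr⁻¹ S) ⟩
  DecoratedListing (expand (lpre S))  ∼⟨ DecoratedListing⇔StickyListing (lpre-prefixClosed S) ⟩
  StickyListing (lpre S)              ∼⟨ StickyListing⇔Sticky S ⟩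
  Sticky S                            ∎
  where
  open EquationalReasoning
  open Expansion (lpre S) using (DecoratedListing⇔StickyListing)

InRS-Ctr⁻¹⇔InS : ∀ n S → InRS n (Ctr⁻¹ S) ⇔ InS n S
InRS-Ctr⁻¹⇔InS n S = Shape-Ctr⁻¹⇔lEdges n S ×-⇔ Decorated-Ctr⁻¹⇔Sticky S

InRS⇔InS-Ctr : ∀ n R → Shape n R → InRS n R ⇔ InS n (Ctr R)
InRS⇔InS-Ctr n R shape =
  subst (λ T → InRS n T ⇔ InS n (Ctr R)) (Ctr⁻¹∘Ctr R shape) (InRS-Ctr⁻¹⇔InS n (Ctr R))

proposition4p2 : (n : ℕ) → 1 ≤ n →
    ((R : DTree) → InRS n R → InS n (Ctr R))
    × ((R R′ : DTree) → InRS n R → InRS n R′ → Ctr R ≡ Ctr R′ → R ≡ R′)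
    × ((S : LTree) → InS n S → ∃ λ R → InRS n R × Ctr R ≡ S)
    × ((R : DTree) → Shape n R → (InRS n R ⇔ InS n (Ctr R)))
proposition4p2 n _ = preserves , injective , surjective , InRS⇔InS-Ctr n
  where
  preserves : (R : DTree) → InRS n R → InS n (Ctr R)
  preserves R r = Equivalence.to (InRS⇔InS-Ctr n R (proj₁ r)) r

  injective : (R R′ : DTree) → InRS n R → InRS n R′ → Ctr R ≡ Ctr R′ → R ≡ R′
  injective R R′ (shape , _) (shape′ , _) eq =
    trans (sym (Ctr⁻¹∘Ctr R shape)) (trans (cong Ctr⁻¹ eq) (Ctr⁻¹∘Ctr R′ shape′))

  surjective : (S : LTree) → InS n S → ∃ λ R → InRS n R × Ctr R ≡ S
  surjective S s = Ctr⁻¹ S , Equivalence.from (InRS-Ctr⁻¹⇔InS n S) s , Ctr∘Ctr⁻¹ S
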